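{- Let $n\ge 0$. (1) If $\alpha=(\alpha_1,\ldots,\alpha_{n+1})\in\mathbb{N}_0^{n+1}$ is a vector such that $\alpha_{n+1}\neq 0$ and for every $1\le i\le n+1$ either $\alpha_i=0$ or $\sum_{j=1}^{i}\alpha_j=i$, then $\alpha=c(S)$ for one and only one subset $S\subseteq\{1,\ldots,n\}$. (2) Any such $\alpha$ is determined by the set of positions of its zero entries (two such vectors with the same zero positions are equal). (3) Any such $\alpha$ is determined by the sequence of its nonzero entries in order (two such vectors whose nonzero entries, read left to right, form the same sequence are equal).
   Context: $\mathbb{N}_0$ denotes the nonnegative integers. For $S\subseteq\{1,\ldots,n\}$, its code $c(S)\in\mathbb{N}_0^{n+1}$ is defined recursively by $c(S)_i=0$ if $i\in S$ and $c(S)_i=i-\sum_{j=1}^{i-1}c(S)_j$ if $i\notin S$, for $1\le i\le n+1$. -}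

module Defs where

open import Data.Nat using (ℕ; zero; suc; _+_; _∸_; _≟_)
open import Data.Bool using (Bool; true; false; if_then_else_)
open import Data.Fin using (Fin; zero; suc; fromℕ)
open import Data.Vec using (Vec; []; _∷_; lookup; toList; last)
open import Data.Fin.Subset using (Subset)
open import Data.List using (List; filter)
open import Data.Sum using (_⊎_)
open import Data.Product using (_×_)
open import Relation.Binary.PropositionalEquality using (_≡_)
open import Relation.Nullary using (¬_)
open import Relation.Nullary.Decidable using (¬?)

-- A subset S ⊆ {1,…,n} is a Subset n (Vec Bool n); position i (1-based)
-- corresponds to the Fin index i-1; 'inside' = true means i ∈ S.

-- codeFrom i acc s : the entries c_i, c_{i+1}, … of the code, where
-- i is the current (1-based) position and acc = Σ_{j<i} c_j.
-- The final entry (position n+1) is never in S.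
codeFrom : ∀ {m} → ℕ → ℕ → Subset m → Vec ℕ (suc m)
codeFrom i acc []          = (i ∸ acc) ∷ []
codeFrom i acc (true ∷ s)  = 0 ∷ codeFrom (suc i) acc s
codeFrom i acc (false ∷ s) = (i ∸ acc) ∷ codeFrom (suc i) (acc + (i ∸ acc)) s

code : ∀ {n} → Subset n → Vec ℕ (suc n)
code s = codeFrom 1 0 s

prefixSum : ∀ {m} → Vec ℕ m → Fin m → ℕ
prefixSum (x ∷ xs) zero    = x
prefixSum (x ∷ xs) (suc k) = x + prefixSum xs k

pos : ∀ {m} → Fin m → ℕ
pos zero    = 1
pos (suc k) = suc (pos k)

Admissible : ∀ {n} → Vec ℕ (suc n) → Set
Admissible {n} α =
  ¬ (lookup α (fromℕ n) ≡ 0) ×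
  ((k : Fin (suc n)) → (lookup α k ≡ 0) ⊎ (prefixSum α k ≡ pos k))

nonzeroEntries : ∀ {m} → Vec ℕ m → List ℕ
nonzeroEntries α = filter (λ x → ¬? (x ≟ 0)) (toList α)

-- Let d be the current position minus the sum of all earlier entries; it starts at 1. Reading
-- c(S) from left to right, an entry in S is 0 and increases d by one, while an entry outside S
-- equals d and resets d to 1. Admissibility of α says exactly that each nonzero entry equals d,
-- so α is the code of its set of zero positions, and S is recovered from c(S) as that set.
-- Moreover each nonzero entry d is preceded by exactly d − 1 zeros, so α can be rebuilt from
-- its nonzero entries.
{-# OPTIONS --safe #-}
module Submission where

open import Defs
open import Data.Nat using (ℕ; zero; suc; pred; _+_; _≡ᵇ_)
open import Data.Nat.Properties using (+-comm; +-suc; +-cancelˡ-≡; m+n∸n≡m)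
open import Data.Bool using (true; false)
open import Data.Fin using (Fin; zero; suc; fromℕ)
open import Data.Fin.Subset using (Subset)
open import Data.Vec using (Vec; []; _∷_; lookup; toList)
open import Data.Vec.Properties using (toList-injective; cast-is-id)
open import Data.List using (List; []; _∷_; _++_; replicate)
open import Data.Product using (_×_; ∃-syntax; _,_)
open import Data.Sum using (_⊎_; inj₁; inj₂)
open import Relation.Binary.PropositionalEquality
  using (_≡_; refl; sym; trans; cong; cong₂; module ≡-Reasoning)
open import Relation.Nullary using (¬_; contradiction)
open import Function.Bundles using (_⇔_; Equivalence)

-- The rest of a code from a position where d = suc g.
codeGap : ∀ {m} → ℕ → Subset m → Vec ℕ (suc m)
codeGap g []          = suc g ∷ []
codeGap g (true ∷ s)  = 0 ∷ codeGap (suc g) s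
codeGap g (false ∷ s) = suc g ∷ codeGap 0 s

codeFrom≡codeGap : ∀ {m} g acc (s : Subset m) → codeFrom (suc (g + acc)) acc s ≡ codeGap g s
codeFrom≡codeGap g acc [] = cong (_∷ []) (m+n∸n≡m (suc g) acc)
codeFrom≡codeGap g acc (true ∷ s) = cong (0 ∷_) (codeFrom≡codeGap (suc g) acc s)
codeFrom≡codeGap g acc (false ∷ s)
  rewrite m+n∸n≡m (suc g) acc | +-comm acc (suc g) =
  cong (suc g ∷_) (codeFrom≡codeGap 0 (suc (g + acc)) s)

code≡codeGap : ∀ {m} (s : Subset m) → code s ≡ codeGap 0 s
code≡codeGap = codeFrom≡codeGap 0 0

-- The last entry is ignored: position n+1 is never in S.
zeroPositions : ∀ {m} → Vec ℕ (suc m) → Subset m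
zeroPositions {zero}  _        = []
zeroPositions {suc m} (x ∷ xs) = (x ≡ᵇ 0) ∷ zeroPositions xs

zeroPositions-codeGap : ∀ {m} g (s : Subset m) → zeroPositions (codeGap g s) ≡ s
zeroPositions-codeGap g []          = refl
zeroPositions-codeGap g (true ∷ s)  = cong (true ∷_) (zeroPositions-codeGap (suc g) s)
zeroPositions-codeGap g (false ∷ s) = cong (false ∷_) (zeroPositions-codeGap 0 s)

zeroPositions-code : ∀ {m} (s : Subset m) → zeroPositions (code s) ≡ s
zeroPositions-code s = trans (cong zeroPositions (code≡codeGap s)) (zeroPositions-codeGap 0 s)

≡codeGap-zeroPositions : ∀ {m} g (α : Vec ℕ (suc m)) → ¬ (lookup α (fromℕ m) ≡ 0) →
  (∀ k → (lookup α k ≡ 0) ⊎ (prefixSum α k ≡ g + pos k)) →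
  α ≡ codeGap g (zeroPositions α)
≡codeGap-zeroPositions {zero} g (x ∷ []) last≢0 admissible with admissible zero
... | inj₁ x≡0   = contradiction x≡0 last≢0
... | inj₂ 1+x≡1+g+1 = cong (_∷ []) (trans 1+x≡1+g+1 (+-comm g 1))
≡codeGap-zeroPositions {suc m} g (zero ∷ xs) last≢0 admissible =
  cong (0 ∷_) (≡codeGap-zeroPositions (suc g) xs last≢0 admissibleTail)
  where
  admissibleTail : ∀ k → (lookup xs k ≡ 0) ⊎ (prefixSum xs k ≡ suc g + pos k)
  admissibleTail k with admissible (suc k)
  ... | inj₁ xₖ≡0 = inj₁ xₖ≡0
  ... | inj₂ sum≡ = inj₂ (trans sum≡ (+-suc g (pos k)))
≡codeGap-zeroPositions {suc m} g (suc x ∷ xs) last≢0 admissible with admissible zero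
... | inj₁ ()
... | inj₂ x+1≡g+1 =
  cong₂ _∷_ 1+x≡1+g (≡codeGap-zeroPositions 0 xs last≢0 admissibleTail)
  where
  1+x≡1+g : suc x ≡ suc g
  1+x≡1+g = trans x+1≡g+1 (+-comm g 1)
  admissibleTail : ∀ k → (lookup xs k ≡ 0) ⊎ (prefixSum xs k ≡ pos k)
  admissibleTail k with admissible (suc k)
  ... | inj₁ xₖ≡0 = inj₁ xₖ≡0
  ... | inj₂ sum≡ = inj₂ (+-cancelˡ-≡ (suc g) _ _ (begin
    suc g + prefixSum xs k ≡⟨ cong (_+ prefixSum xs k) (sym 1+x≡1+g) ⟩
    suc x + prefixSum xs k ≡⟨ sum≡ ⟩
    g + suc (pos k)        ≡⟨ +-suc g (pos k) ⟩
    suc g + pos k          ∎))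
    where open ≡-Reasoning

admissible⇒≡code : ∀ {n} (α : Vec ℕ (suc n)) → Admissible α → α ≡ code (zeroPositions α)
admissible⇒≡code α (last≢0 , admissible) =
  trans (≡codeGap-zeroPositions 0 α last≢0 admissible) (sym (code≡codeGap (zeroPositions α)))

zeroPositions-cong : ∀ {m} (α β : Vec ℕ (suc m)) →
  (∀ k → (lookup α k ≡ 0) ⇔ (lookup β k ≡ 0)) → zeroPositions α ≡ zeroPositions β
zeroPositions-cong {zero}  _        _        _       = refl
zeroPositions-cong {suc m} (x ∷ xs) (y ∷ ys) sameZeros =
  cong₂ _∷_ (isZero-cong x y (sameZeros zero)) (zeroPositions-cong xs ys (λ k → sameZeros (suc k)))
  where
  isZero-cong : ∀ x y → (x ≡ 0) ⇔ (y ≡ 0) → (x ≡ᵇ 0) ≡ (y ≡ᵇ 0)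
  isZero-cong zero    zero    _ = refl
  isZero-cong zero    (suc y) x≡0⇔y≡0 with () ← Equivalence.to x≡0⇔y≡0 refl
  isZero-cong (suc x) zero    x≡0⇔y≡0 with () ← Equivalence.from x≡0⇔y≡0 refl
  isZero-cong (suc x) (suc y) _ = refl

expand : List ℕ → List ℕ
expand []       = []
expand (x ∷ xs) = replicate (pred x) 0 ++ x ∷ expand xs

replicate-++-∷ : ∀ {A : Set} n (x : A) xs → replicate n x ++ x ∷ xs ≡ x ∷ replicate n x ++ xs
replicate-++-∷ zero    x xs = refl
replicate-++-∷ (suc n) x xs = cong (x ∷_) (replicate-++-∷ n x xs)

expand-nonzeroEntries-codeGap : ∀ {m} g (s : Subset m) →
  expand (nonzeroEntries (codeGap g s)) ≡ replicate g 0 ++ toList (codeGap g s)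
expand-nonzeroEntries-codeGap g []          = refl
expand-nonzeroEntries-codeGap g (true ∷ s)  =
  trans (expand-nonzeroEntries-codeGap (suc g) s)
        (sym (replicate-++-∷ g 0 (toList (codeGap (suc g) s))))
expand-nonzeroEntries-codeGap g (false ∷ s) =
  cong (λ rest → replicate g 0 ++ suc g ∷ rest) (expand-nonzeroEntries-codeGap 0 s)

admissible⇒expand-nonzeroEntries : ∀ {n} (α : Vec ℕ (suc n)) → Admissible α →
  expand (nonzeroEntries α) ≡ toList α
admissible⇒expand-nonzeroEntries {n} α (last≢0 , admissible) = begin
  expand (nonzeroEntries α)               ≡⟨ cong (λ v → expand (nonzeroEntries v)) α≡codeGap ⟩
  expand (nonzeroEntries (codeGap 0 zs))  ≡⟨ expand-nonzeroEntries-codeGap 0 zs ⟩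
  toList (codeGap 0 zs)                   ≡⟨ cong toList (sym α≡codeGap) ⟩
  toList α                                ∎
  where
  open ≡-Reasoning
  zs : Subset n
  zs = zeroPositions α
  α≡codeGap : α ≡ codeGap 0 zs
  α≡codeGap = ≡codeGap-zeroPositions 0 α last≢0 admissible

lemma1 : (n : ℕ) →
    ((α : Vec ℕ (suc n)) → Admissible α →
      ∃[ S ] ((code S ≡ α) × ((T : Subset n) → code T ≡ α → T ≡ S)))
    × ((α β : Vec ℕ (suc n)) → Admissible α → Admissible β →
      ((k : Fin (suc n)) → (lookup α k ≡ 0) ⇔ (lookup β k ≡ 0)) → α ≡ β)
    × ((α β : Vec ℕ (suc n)) → Admissible α → Admissible β →
      nonzeroEntries α ≡ nonzeroEntries β → α ≡ β)
lemma1 n = existsUniqueSubset , determinedByZeros , determinedByNonzeroEntries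
  where
  existsUniqueSubset : (α : Vec ℕ (suc n)) → Admissible α →
    ∃[ S ] ((code S ≡ α) × ((T : Subset n) → code T ≡ α → T ≡ S))
  existsUniqueSubset α adm =
    zeroPositions α , sym (admissible⇒≡code α adm) ,
    λ T codeT≡α → trans (sym (zeroPositions-code T)) (cong zeroPositions codeT≡α)

  determinedByZeros : (α β : Vec ℕ (suc n)) → Admissible α → Admissible β →
    ((k : Fin (suc n)) → (lookup α k ≡ 0) ⇔ (lookup β k ≡ 0)) → α ≡ β
  determinedByZeros α β admα admβ sameZeros = begin
    α                       ≡⟨ admissible⇒≡code α admα ⟩
    code (zeroPositions α)  ≡⟨ cong code (zeroPositions-cong α β sameZeros) ⟩
    code (zeroPositions β)  ≡⟨ sym (admissible⇒≡code β admβ) ⟩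
    β                       ∎
    where open ≡-Reasoning

  determinedByNonzeroEntries : (α β : Vec ℕ (suc n)) → Admissible α → Admissible β →
    nonzeroEntries α ≡ nonzeroEntries β → α ≡ β
  determinedByNonzeroEntries α β admα admβ sameNonzero =
    trans (sym (cast-is-id refl α)) (toList-injective refl α β (begin
    toList α                   ≡⟨ sym (admissible⇒expand-nonzeroEntries α admα) ⟩
    expand (nonzeroEntries α)  ≡⟨ cong expand sameNonzero ⟩
    expand (nonzeroEntries β)  ≡⟨ admissible⇒expand-nonzeroEntries β admβ ⟩
    toList β                   ∎))
    where open ≡-Reasoning
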